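{- For each integer $n \ge 1$, let $C_n$ be the chain $a_0 < a_1 < \cdots < a_{n-1}$ with $\wedge = \min$, $\vee = \max$, $0 = a_0$, $1 = a_{n-1}$, and let $N(n)$ be the number of binary operations $\to$ on $C_n$ such that $\langle C_n, \vee, \wedge, \to, 0, 1\rangle$ is a semi-Heyting algebra. Then for every $n \ge 2$, $$N(n) = \left(\sum_{i=0}^{n-1} \frac{(n-1)!}{i!}\right) N(n-1).$$
   Context: An algebra $\langle L, \vee, \wedge, \to, 0, 1\rangle$ is a semi-Heyting algebra if: (SH1) $\langle L, \vee, \wedge, 0, 1\rangle$ is a lattice with least element $0$ and greatest element $1$; (SH2) $x \wedge (x \to y) = x \wedge y$ for all $x,y$; (SH3) $x \wedge (y \to z) = x \wedge [(x \wedge y) \to (x \wedge z)]$ for all $x,y,z$; (SH4) $x \to x = 1$ for all $x$. -}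

module Defs where

open import Data.Nat using (ℕ; zero; suc; _≤ᵇ_; _∸_; _*_; _!)
open import Data.Nat.Properties using (_!≢0)
open import Data.Nat.DivMod using (_/_)
open import Data.Fin using (Fin; toℕ; fromℕ)
open import Data.Fin.Properties using (all?) renaming (_≟_ to _≟ᶠ_)
open import Data.Bool using (if_then_else_)
open import Data.Vec using (Vec; []; _∷_; lookup)
open import Data.List using (List; []; _∷_; allFin; length; filter; cartesianProductWith; map; upTo)
open import Data.Nat.ListAction using (sum)
open import Data.Product using (_×_)
open import Relation.Nullary.Decidable using (Dec; _×-dec_)
open import Relation.Binary.PropositionalEquality using (_≡_)

-- The chain C_n = a_0 < ... < a_{n-1} is modelled by Fin n (a_i = i),
-- with meet = min and join = max.
_⊓_ : ∀ {n} → Fin n → Fin n → Fin n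
x ⊓ y = if toℕ x ≤ᵇ toℕ y then x else y

_⊔_ : ∀ {n} → Fin n → Fin n → Fin n
x ⊔ y = if toℕ x ≤ᵇ toℕ y then y else x

-- A binary operation on Fin n, represented by its (finite) operation table,
-- so that distinct tables are exactly distinct operations.
Table : ℕ → Set
Table n = Vec (Vec (Fin n) n) n

app : ∀ {n} → Table n → Fin n → Fin n → Fin n
app t x y = lookup (lookup t x) y

allVecs : ∀ {A : Set} (m : ℕ) → List A → List (Vec A m)
allVecs zero    xs = [] ∷ []
allVecs (suc m) xs = cartesianProductWith _∷_ xs (allVecs m xs)

allTables : (n : ℕ) → List (Table n)
allTables n = allVecs n (allVecs n (allFin n))

-- Semi-Heyting axioms on the chain C_(suc m) (0 = a_0, 1 = a_m).
-- (SH1) holds automatically: (Fin (suc m), max, min, a_0, a_m) is a bounded lattice.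
IsSemiHeyting : ∀ {m} → Table (suc m) → Set
IsSemiHeyting {m} t =
  (∀ x y → x ⊓ app t x y ≡ x ⊓ y) ×
  (∀ x y z → x ⊓ app t y z ≡ x ⊓ app t (x ⊓ y) (x ⊓ z)) ×
  (∀ x → app t x x ≡ fromℕ m)

isSemiHeyting? : ∀ {m} (t : Table (suc m)) → Dec (IsSemiHeyting t)
isSemiHeyting? {m} t =
  all? (λ x → all? (λ y → (x ⊓ app t x y) ≟ᶠ (x ⊓ y)))
  ×-dec all? (λ x → all? (λ y → all? (λ z →
          (x ⊓ app t y z) ≟ᶠ (x ⊓ app t (x ⊓ y) (x ⊓ z)))))
  ×-dec all? (λ x → app t x x ≟ᶠ fromℕ m)

-- N n : number of binary operations → on C_n making it a semi-Heyting algebra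
-- (defined for n ≥ 1; the value at 0 is a dummy and never used).
N : ℕ → ℕ
N zero    = 0
N (suc m) = length (filter isSemiHeyting? (allTables (suc m)))

-- (n-1)!/i!  (exact division, since i ≤ n-1)
ratio : ℕ → ℕ → ℕ
ratio n i = ((n ∸ 1) !) / (i !)
  where instance _ = i !≢0

coeff : ℕ → ℕ
coeff n = sum (map (ratio n) (upTo n))

module Submission where

-- On the chain 0 < 1 < … < m an operation → makes a semi-Heyting algebra iff every
-- cell (y, z) of its table is admissible:
--   y → z = z if z < y,   y → y = m,   and if y < z:  y ≤ y → z  and
--   x ⊓ (y → z) = x ⊓ (y → x)  for all y < x < z.
-- Admissibility of a cell only involves its own row, so N (m + 1) is the product over
-- the rows y of the number of admissible rows y.  Read from left to right, a row is
-- forced up to and including the diagonal; afterwards it is free (each value is at least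
-- its position) until at some position q + 1 it may drop to the value q, after which it
-- is stuck and all later values equal q.  So the L positions after the diagonal admit
-- arrangements L = L · arrangements (L − 1) + 1 choices, N (m + 1) = ∏_{y ≤ m} arrangements (m − y),
-- and N (n) = arrangements (n − 1) · N (n − 1).  Finally Σ_{i<n} (n − 1)!/i! obeys the same
-- recurrence, which gives the theorem.

open import Defs
open import Data.Nat using (ℕ; zero; suc; _+_; _*_; _∸_; _≤_; _<_; _≤?_; _<?_; _≟_; _≤ᵇ_; _!;
  z≤n; s≤s; s≤s⁻¹) renaming (_⊓_ to _⊓ₙ_)
open import Data.Nat.Properties
open import Data.Nat.DivMod using (*-/-assoc; n/n≡1)
open import Data.Nat.Divisibility using (m≤n⇒m!∣n!)
open import Data.Nat.ListAction using (sum)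
open import Data.Nat.ListAction.Properties using (sum-++)
open import Data.Nat.Tactic.RingSolver using (solve-∀)
open import Data.Bool using (true; false; if_then_else_)
open import Data.Empty using (⊥-elim)
open import Data.Unit using (⊤; tt)
open import Data.List using (List; []; _∷_; _++_; _∷ʳ_; map; length; filter; cartesianProductWith;
  allFin; tabulate; upTo)
open import Data.List.Properties using (length-++; filter-++; filter-≐; map-cong; map-cong-local;
  map-tabulate; map-++; upTo-∷ʳ)
open import Data.List.Relation.Unary.All.Properties using (applyUpTo⁺₁)
open import Data.Vec using (Vec; []; _∷_; lookup)
open import Data.Fin using (Fin; toℕ; fromℕ; fromℕ<) renaming (zero to fzero; suc to fsuc)
open import Data.Fin.Properties using (all?; toℕ-injective; toℕ-fromℕ; toℕ-fromℕ<; toℕ<n; toℕ≤pred[n])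
open import Data.Product using (_×_; _,_; proj₁; proj₂)
open import Function using (_∘_; id)
open import Function.Bundles using (_⇔_; mk⇔; Equivalence)
open import Relation.Binary using (tri<; tri≈; tri>)
open import Relation.Nullary using (Dec; yes; no; does; ¬_; contradiction)
open import Relation.Nullary.Reflects using (ofʸ; ofⁿ)
open import Relation.Nullary.Decidable using (_×-dec_; _→-dec_; dec-true; dec-false)
open import Relation.Unary using (Decidable; _≐_)
open import Relation.Binary.PropositionalEquality
open ≡-Reasoning

variable
  A B : Set
  L : ℕ

count : {P : A → Set} → Decidable P → List A → ℕ
count P? xs = length (filter P? xs)

count-≐ : {P Q : A → Set} (P? : Decidable P) (Q? : Decidable Q) → P ≐ Q →
          ∀ xs → count P? xs ≡ count Q? xs
count-≐ P? Q? P≐Q xs = cong length (filter-≐ P? Q? P≐Q xs)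

count-none : {P : A → Set} (P? : Decidable P) → (∀ x → ¬ P x) → ∀ xs → count P? xs ≡ 0
count-none P? ¬P [] = refl
count-none P? ¬P (x ∷ xs) with P? x
... | yes p = ⊥-elim (¬P x p)
... | no _ = count-none P? ¬P xs

count-∷ : {P : A → Set} (P? : Decidable P) → ∀ x xs →
          count P? (x ∷ xs) ≡ (if does (P? x) then 1 else 0) + count P? xs
count-∷ P? x xs with does (P? x)
... | true = refl
... | false = refl

count-map : {P : B → Set} (P? : Decidable P) (f : A → B) →
            ∀ xs → count P? (map f xs) ≡ count (P? ∘ f) xs
count-map P? f [] = refl
count-map P? f (x ∷ xs) with does (P? (f x))
... | true = cong suc (count-map P? f xs)
... | false = count-map P? f xs

count-cart : {P : Vec A (suc L) → Set} (P? : Decidable P) (xs : List A) (vs : List (Vec A L)) →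
             count P? (cartesianProductWith _∷_ xs vs) ≡ sum (map (λ a → count (P? ∘ (a ∷_)) vs) xs)
count-cart P? [] vs = refl
count-cart P? (x ∷ xs) vs = begin
  length (filter P? (map (x ∷_) vs ++ rest))                  ≡⟨ cong length (filter-++ P? (map (x ∷_) vs) rest) ⟩
  length (filter P? (map (x ∷_) vs) ++ filter P? rest)        ≡⟨ length-++ (filter P? (map (x ∷_) vs)) ⟩
  count P? (map (x ∷_) vs) + count P? rest                    ≡⟨ cong₂ _+_ (count-map P? (x ∷_) vs) (count-cart P? xs vs) ⟩
  count (P? ∘ (x ∷_)) vs + sum (map (λ a → count (P? ∘ (a ∷_)) vs) xs) ∎
  where rest = cartesianProductWith _∷_ xs vs

count-guard : {Q : Set} {R : A → Set} (Q? : Dec Q) (R? : Decidable R) →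
              ∀ xs → count (λ x → Q? ×-dec R? x) xs ≡ (if does Q? then count R? xs else 0)
count-guard (yes q) R? xs = count-≐ _ R? (proj₂ , (q ,_)) xs
count-guard (no ¬q) R? xs = count-none _ (λ _ → ¬q ∘ proj₁) xs

sum-guard : {Q : A → Set} (Q? : Decidable Q) (K : ℕ) →
            ∀ xs → sum (map (λ a → if does (Q? a) then K else 0) xs) ≡ count Q? xs * K
sum-guard Q? K [] = refl
sum-guard Q? K (x ∷ xs) with does (Q? x)
... | true = cong (K +_) (sum-guard Q? K xs)
... | false = sum-guard Q? K xs

sum-+ : (f g : A → ℕ) → ∀ xs → sum (map (λ a → f a + g a) xs) ≡ sum (map f xs) + sum (map g xs)
sum-+ f g [] = refl
sum-+ f g (x ∷ xs) = begin
  f x + g x + sum (map (λ a → f a + g a) xs)   ≡⟨ cong (f x + g x +_) (sum-+ f g xs) ⟩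
  f x + g x + (sum (map f xs) + sum (map g xs)) ≡⟨ swap (f x) (g x) (sum (map f xs)) (sum (map g xs)) ⟩
  f x + sum (map f xs) + (g x + sum (map g xs)) ∎
  where
  swap : ∀ a b c d → a + b + (c + d) ≡ a + c + (b + d)
  swap = solve-∀

sum-* : ∀ c (f : A → ℕ) xs → sum (map (λ a → c * f a) xs) ≡ c * sum (map f xs)
sum-* c f []       = sym (*-zeroʳ c)
sum-* c f (x ∷ xs) = trans (cong (c * f x +_) (sum-* c f xs)) (sym (*-distribˡ-+ c (f x) (sum (map f xs))))

if-yes : ∀ {P : Set} (P? : Dec P) {x y : A} → P → (if does P? then x else y) ≡ x
if-yes P? p rewrite dec-true P? p = refl

if-no : ∀ {P : Set} (P? : Dec P) {x y : A} → ¬ P → (if does P? then x else y) ≡ y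
if-no P? ¬p rewrite dec-false P? ¬p = refl

count-allFin-suc : ∀ {n} {P : Fin (suc n) → Set} (P? : Decidable P) →
                   count P? (allFin (suc n)) ≡ (if does (P? fzero) then 1 else 0) + count (P? ∘ fsuc) (allFin n)
count-allFin-suc {n} P? = trans (count-∷ P? fzero _) (cong (_ +_) (begin
  count P? (tabulate fsuc)         ≡⟨ cong (count P?) (sym (map-tabulate id fsuc)) ⟩
  count P? (map fsuc (allFin n))   ≡⟨ count-map P? fsuc (allFin n) ⟩
  count (P? ∘ fsuc) (allFin n)     ∎))

count-toℕ≡ : ∀ {n} c → c < n → count (λ (a : Fin n) → toℕ a ≟ c) (allFin n) ≡ 1
count-toℕ≡ {suc n} zero _ = trans (count-allFin-suc {n} (λ a → toℕ a ≟ 0))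
  (cong suc (count-none (λ a → suc (toℕ a) ≟ 0) (λ _ ()) (allFin n)))
count-toℕ≡ {suc n} (suc c) c<n = begin
  count (λ a → toℕ a ≟ suc c) (allFin (suc n))         ≡⟨ count-allFin-suc {n} (λ a → toℕ a ≟ suc c) ⟩
  count (λ a → suc (toℕ a) ≟ suc c) (allFin n)          ≡⟨ count-≐ _ _ (suc-injective , cong suc) (allFin n) ⟩
  count (λ a → toℕ a ≟ c) (allFin n)                    ≡⟨ count-toℕ≡ c (s≤s⁻¹ c<n) ⟩
  1                                                     ∎

count-≤toℕ : ∀ {n} p → count (λ (a : Fin n) → p ≤? toℕ a) (allFin n) ≡ n ∸ p
count-≤toℕ {zero} p = sym (0∸n≡0 p)
count-≤toℕ {suc n} zero = trans (count-allFin-suc {n} (λ a → 0 ≤? toℕ a))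
  (cong suc (trans (count-≐ _ _ ((λ _ → z≤n) , (λ _ → z≤n)) (allFin n)) (count-≤toℕ zero)))
count-≤toℕ {suc n} (suc p) = begin
  count (λ a → suc p ≤? toℕ a) (allFin (suc n))         ≡⟨ count-allFin-suc {n} (λ a → suc p ≤? toℕ a) ⟩
  count (λ a → suc p ≤? suc (toℕ a)) (allFin n)         ≡⟨ count-≐ _ _ (s≤s⁻¹ , s≤s) (allFin n) ⟩
  count (λ a → p ≤? toℕ a) (allFin n)                   ≡⟨ count-≤toℕ p ⟩
  n ∸ p                                                 ∎

∏ : (Fin L → ℕ) → ℕ
∏ {zero} f = 1
∏ {suc L} f = f fzero * ∏ (f ∘ fsuc)

∏-cong : ∀ {f g : Fin L → ℕ} → (∀ i → f i ≡ g i) → ∏ f ≡ ∏ g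
∏-cong {zero}  e = refl
∏-cong {suc L} e = cong₂ _*_ (e fzero) (∏-cong (e ∘ fsuc))

count-allVecs : {P : Fin L → A → Set} (P? : ∀ i → Decidable (P i)) (xs : List A) →
                count (λ v → all? (λ i → P? i (lookup v i))) (allVecs L xs) ≡ ∏ (λ i → count (P? i) xs)
count-allVecs {zero} P? xs = refl
count-allVecs {suc L} {P = P} P? xs = begin
  count All? (allVecs (suc L) xs)                                  ≡⟨ count-cart All? xs (allVecs L xs) ⟩
  sum (map (λ a → count (All? ∘ (a ∷_)) (allVecs L xs)) xs)        ≡⟨ cong sum (map-cong split xs) ⟩
  sum (map (λ a → if does (P? fzero a) then tail else 0) xs)       ≡⟨ sum-guard (P? fzero) tail xs ⟩
  count (P? fzero) xs * tail                                       ≡⟨ cong (count (P? fzero) xs *_) (count-allVecs (P? ∘ fsuc) xs) ⟩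
  ∏ (λ i → count (P? i) xs)                                        ∎
  where
  All? : Decidable (λ v → ∀ i → P i (lookup v i))
  All? v = all? (λ i → P? i (lookup v i))
  Tail? : Decidable (λ v → ∀ i → P (fsuc i) (lookup v i))
  Tail? v = all? (λ i → P? (fsuc i) (lookup v i))
  tail : ℕ
  tail = count Tail? (allVecs L xs)
  -- ∀ i. P i ((a ∷ v) i)  is  P 0 a  together with  ∀ i. P (1 + i) (v i)
  split : ∀ a → count (All? ∘ (a ∷_)) (allVecs L xs) ≡ (if does (P? fzero a) then tail else 0)
  split a = trans (count-≐ (All? ∘ (a ∷_)) (λ v → P? fzero a ×-dec Tail? v)
                           ((λ f → f fzero , f ∘ fsuc) , λ { (p , f) fzero → p ; (p , f) (fsuc i) → f i })
                           (allVecs L xs))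
                  (count-guard (P? fzero a) Tail? (allVecs L xs))

toℕ-⊓ : ∀ {n} (a b : Fin n) → toℕ (a ⊓ b) ≡ toℕ a ⊓ₙ toℕ b
toℕ-⊓ a b with toℕ a ≤ᵇ toℕ b | ≤ᵇ-reflects-≤ (toℕ a) (toℕ b)
... | true  | ofʸ a≤b = sym (m≤n⇒m⊓n≡m a≤b)
... | false | ofⁿ a≰b = sym (m≥n⇒m⊓n≡n (≰⇒≥ a≰b))

⊓-cong : ∀ {n} (x a b : Fin n) → toℕ x ⊓ₙ toℕ a ≡ toℕ x ⊓ₙ toℕ b → x ⊓ a ≡ x ⊓ b
⊓-cong x a b e = toℕ-injective (trans (toℕ-⊓ x a) (trans e (sym (toℕ-⊓ x b))))

⊓-cong⁻ : ∀ {n} (x a b : Fin n) → x ⊓ a ≡ x ⊓ b → toℕ x ⊓ₙ toℕ a ≡ toℕ x ⊓ₙ toℕ b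
⊓-cong⁻ x a b e = trans (sym (toℕ-⊓ x a)) (trans (cong toℕ e) (toℕ-⊓ x b))

⊓-≥ : ∀ {n} (a b : Fin n) → toℕ b ≤ toℕ a → a ⊓ b ≡ b
⊓-≥ a b b≤a = toℕ-injective (trans (toℕ-⊓ a b) (m≥n⇒m⊓n≡n b≤a))

⊓-≤ : ∀ {n} (a b : Fin n) → toℕ a ≤ toℕ b → a ⊓ b ≡ a
⊓-≤ a b a≤b = toℕ-injective (trans (toℕ-⊓ a b) (m≤n⇒m⊓n≡m a≤b))

⊓-below : ∀ {x a b} → x ⊓ₙ a ≡ b → b < x → a ≡ b
⊓-below {x} {a} e b<x with a ≤? x
... | yes a≤x = trans (sym (m≥n⇒m⊓n≡n a≤x)) e
... | no a≰x = ⊥-elim (<-irrefl (sym (trans (sym (m≤n⇒m⊓n≡m (<⇒≤ (≰⇒> a≰x)))) e)) b<x)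

-- Cell (y, z) of an implication on the chain with top m, read numerically: a is the
-- value of y → z and h x the value of y → x at the earlier positions x < z.  These are
-- the conditions characterizing semi-Heyting implications on chains.
Admissible : (m y z a : ℕ) → (ℕ → ℕ) → Set
Admissible m y z a h =
  (z < y → a ≡ z) × (z ≡ y → a ≡ m) ×
  (y < z → y ≤ a × (∀ {x} → x < z → y < x → x ⊓ₙ a ≡ x ⊓ₙ h x))

admissible? : ∀ m y z a h → Dec (Admissible m y z a h)
admissible? m y z a h =
  (z <? y →-dec a ≟ z) ×-dec (z ≟ y →-dec a ≟ m) ×-dec
  (y <? z →-dec (y ≤? a ×-dec allUpTo? (λ x → y <? x →-dec x ⊓ₙ a ≟ x ⊓ₙ h x) z))

admissible-meet : ∀ {m y z a h} → Admissible m y z a h → y ≤ m → y ⊓ₙ a ≡ y ⊓ₙ z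
admissible-meet {y = y} {z} (below , diagonal , above) y≤m with <-cmp z y
... | tri< z<y _ _ = cong (y ⊓ₙ_) (below z<y)
... | tri≈ _ refl _ = trans (cong (y ⊓ₙ_) (diagonal refl)) (trans (m≤n⇒m⊓n≡m y≤m) (sym (m≤n⇒m⊓n≡m ≤-refl)))
... | tri> _ _ y<z = trans (m≤n⇒m⊓n≡m (proj₁ (above y<z))) (sym (m≤n⇒m⊓n≡m (<⇒≤ y<z)))

extend : (ℕ → ℕ) → ℕ → ℕ → ℕ → ℕ
extend h p a x with x ≟ p
... | yes _ = a
... | no _  = h x

extend-agrees : ∀ {h g : ℕ → ℕ} {p a} → (∀ {x} → x < p → h x ≡ g x) → a ≡ g p →
                ∀ {x} → x < suc p → extend h p a x ≡ g x
extend-agrees {p = p} h≈g a≡gp {x} x<1+p with x ≟ p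
... | yes refl = a≡gp
... | no x≢p   = h≈g (≤∧≢⇒< (s≤s⁻¹ x<1+p) x≢p)

admissible-local : ∀ {m y z a} {h g : ℕ → ℕ} → (∀ {x} → x < z → h x ≡ g x) →
                   Admissible m y z a h → Admissible m y z a g
admissible-local h≈g (below , diagonal , above) =
  below , diagonal , λ y<z → proj₁ (above y<z) ,
    λ {x} x<z y<x → trans (proj₂ (above y<z) x<z y<x) (cong (x ⊓ₙ_) (h≈g x<z))

-- v is an admissible continuation, from position p on, of row y whose earlier values
-- are recorded in the history h.
Continues : ∀ {n L} (m y p : ℕ) → (ℕ → ℕ) → Vec (Fin n) L → Set
Continues m y p h []      = ⊤
Continues m y p h (a ∷ v) = Admissible m y p (toℕ a) h × Continues m y (suc p) (extend h p (toℕ a)) v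

continues? : ∀ {n L} m y p h (v : Vec (Fin n) L) → Dec (Continues m y p h v)
continues? m y p h []      = yes tt
continues? m y p h (a ∷ v) = admissible? m y p (toℕ a) h ×-dec continues? m y (suc p) (extend h p (toℕ a)) v

continues⇔ : ∀ {n L} m y (v : Vec (Fin n) L) p h (g : ℕ → ℕ) →
             (∀ {x} → x < p → h x ≡ g x) → (∀ i → toℕ (lookup v i) ≡ g (p + toℕ i)) →
             Continues m y p h v ⇔ (∀ (i : Fin L) → Admissible m y (p + toℕ i) (g (p + toℕ i)) g)
continues⇔ {L = zero} m y [] p h g h≈g v≈g = mk⇔ (λ _ ()) (λ _ → tt)
continues⇔ {L = suc L} m y (a ∷ v) p h g h≈g v≈g = mk⇔ to from
  where
  at : ∀ {P : ℕ → Set} → P (p + 0) → P p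
  at {P} = subst P (+-identityʳ p)
  a≡gp : toℕ a ≡ g p
  a≡gp = at {λ x → toℕ a ≡ g x} (v≈g fzero)
  rest : Continues m y (suc p) (extend h p (toℕ a)) v ⇔
         (∀ (i : Fin L) → Admissible m y (suc p + toℕ i) (g (suc p + toℕ i)) g)
  rest = continues⇔ m y v (suc p) (extend h p (toℕ a)) g (extend-agrees h≈g a≡gp)
                    (λ i → trans (v≈g (fsuc i)) (cong g (+-suc p (toℕ i))))
  Adm : ℕ → Set
  Adm x = Admissible m y x (g x) g
  to : Continues m y p h (a ∷ v) → ∀ i → Adm (p + toℕ i)
  to (adm , cont) fzero    = subst Adm (sym (+-identityʳ p))
                               (subst (λ w → Admissible m y p w g) a≡gp (admissible-local h≈g adm))
  to (adm , cont) (fsuc i) = subst Adm (sym (+-suc p (toℕ i))) (Equivalence.to rest cont i)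
  from : (∀ i → Adm (p + toℕ i)) → Continues m y p h (a ∷ v)
  from all = admissible-local (λ x<p → sym (h≈g x<p))
               (subst (λ w → Admissible m y p w g) (sym a≡gp) (at {Adm} (all fzero))) ,
             Equivalence.from rest (λ i → subst Adm (+-suc p (toℕ i)) (all (fsuc i)))

-- A vector over Fin n read as a numeric function of the position (0 beyond its length).
vecℕ : ∀ {n L} → Vec (Fin n) L → ℕ → ℕ
vecℕ []      _       = 0
vecℕ (a ∷ v) zero    = toℕ a
vecℕ (a ∷ v) (suc x) = vecℕ v x

vecℕ-lookup : ∀ {n L} (v : Vec (Fin n) L) i → vecℕ v (toℕ i) ≡ toℕ (lookup v i)
vecℕ-lookup (a ∷ v) fzero    = refl
vecℕ-lookup (a ∷ v) (fsuc i) = vecℕ-lookup v i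

module _ {m : ℕ} (t : Table (suc m)) where

  _⇒_ : Fin (suc m) → Fin (suc m) → ℕ
  y ⇒ z = toℕ (app t y z)

  row : Fin (suc m) → ℕ → ℕ
  row y = vecℕ (lookup t y)

  row-⇒ : ∀ y x → row y (toℕ x) ≡ y ⇒ x
  row-⇒ y x = vecℕ-lookup (lookup t y) x

  AdmissibleTable : Set
  AdmissibleTable = ∀ y z → Admissible m (toℕ y) (toℕ z) (y ⇒ z) (row y)

  ≤top : ∀ (x : Fin (suc m)) → toℕ x ≤ m
  ≤top = toℕ≤pred[n]

  -- The axioms force each cell into the admissible shape: (SH2) gives the cells below and
  -- the lower bound above the diagonal, (SH4) the diagonal, (SH3) the agreement condition.
  semiHeyting⇒admissible : IsSemiHeyting t → AdmissibleTable
  semiHeyting⇒admissible (sh2 , sh3 , sh4) y z = below , diagonal , above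
    where
    meet : toℕ y ⊓ₙ (y ⇒ z) ≡ toℕ y ⊓ₙ toℕ z
    meet = ⊓-cong⁻ y (app t y z) z (sh2 y z)
    below : toℕ z < toℕ y → y ⇒ z ≡ toℕ z
    below z<y = ⊓-below (trans meet (m≥n⇒m⊓n≡n (<⇒≤ z<y))) z<y
    diagonal : toℕ z ≡ toℕ y → y ⇒ z ≡ m
    diagonal z≡y rewrite toℕ-injective z≡y = trans (cong toℕ (sh4 y)) (toℕ-fromℕ m)
    -- (SH3) with x between y and z turns y → z into y → x below x.
    agree : ∀ x → toℕ x < toℕ z → toℕ y < toℕ x → toℕ x ⊓ₙ (y ⇒ z) ≡ toℕ x ⊓ₙ row y (toℕ x)
    agree x x<z y<x = trans (⊓-cong⁻ x _ _ (begin
      x ⊓ app t y z                ≡⟨ sh3 x y z ⟩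
      x ⊓ app t (x ⊓ y) (x ⊓ z)    ≡⟨ cong₂ (λ u v → x ⊓ app t u v) (⊓-≥ x y (<⇒≤ y<x)) (⊓-≤ x z (<⇒≤ x<z)) ⟩
      x ⊓ app t y x                ∎)) (cong (toℕ x ⊓ₙ_) (sym (row-⇒ y x)))
    above : toℕ y < toℕ z → toℕ y ≤ y ⇒ z × (∀ {x} → x < toℕ z → toℕ y < x → x ⊓ₙ (y ⇒ z) ≡ x ⊓ₙ row y x)
    above y<z = subst (_≤ y ⇒ z) (trans meet (m≤n⇒m⊓n≡m (<⇒≤ y<z))) (m⊓n≤n _ _) , agreeℕ
      where
      agreeℕ : ∀ {x} → x < toℕ z → toℕ y < x → x ⊓ₙ (y ⇒ z) ≡ x ⊓ₙ row y x
      -- a position x < z is the number of the element x' = fromℕ< (x < m + 1)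
      agreeℕ {x} x<z y<x with fromℕ< (<-trans x<z (toℕ<n z)) | toℕ-fromℕ< (<-trans x<z (toℕ<n z))
      ... | x' | refl = agree x' x<z y<x

  admissible⇒semiHeyting : AdmissibleTable → IsSemiHeyting t
  admissible⇒semiHeyting adm = sh2 , sh3 , sh4
    where
    below : ∀ y z → toℕ z < toℕ y → y ⇒ z ≡ toℕ z
    below y z = proj₁ (adm y z)
    diagonal : ∀ x → x ⇒ x ≡ m
    diagonal x = proj₁ (proj₂ (adm x x)) refl
    meet : ∀ y z → toℕ y ⊓ₙ (y ⇒ z) ≡ toℕ y ⊓ₙ toℕ z
    meet y z = admissible-meet (adm y z) (≤top y)
    lower : ∀ y z → toℕ y ⊓ₙ toℕ z ≤ y ⇒ z
    lower y z = subst (_≤ y ⇒ z) (meet y z) (m⊓n≤n _ _)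
    x⊓top : ∀ x → toℕ x ⊓ₙ (x ⇒ x) ≡ toℕ x
    x⊓top x = trans (cong (toℕ x ⊓ₙ_) (diagonal x)) (m≤n⇒m⊓n≡m (≤top x))

    sh2 : ∀ x y → x ⊓ app t x y ≡ x ⊓ y
    sh2 x y = ⊓-cong x _ y (meet x y)

    sh3 : ∀ x y z → x ⊓ app t y z ≡ x ⊓ app t (x ⊓ y) (x ⊓ z)
    sh3 x y z with toℕ y <? toℕ x
    sh3 x y z | yes y<x with toℕ z ≤? toℕ x
    ... | yes z≤x rewrite ⊓-≥ x y (<⇒≤ y<x) | ⊓-≥ x z z≤x = refl
    ... | no z≰x rewrite ⊓-≥ x y (<⇒≤ y<x) | ⊓-≤ x z (<⇒≤ (≰⇒> z≰x)) = ⊓-cong x _ _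
          (trans (proj₂ (proj₂ (proj₂ (adm y z)) (<-trans y<x x<z)) x<z y<x) (cong (toℕ x ⊓ₙ_) (row-⇒ y x)))
      where x<z = ≰⇒> z≰x
    sh3 x y z | no y≮x with toℕ z <? toℕ x
    ... | yes z<x rewrite ⊓-≤ x y (≮⇒≥ y≮x) | ⊓-≥ x z (<⇒≤ z<x) = ⊓-cong x _ _
          (trans (cong (toℕ x ⊓ₙ_) (below y z (<-≤-trans z<x x≤y))) (sym (cong (toℕ x ⊓ₙ_) (below x z z<x))))
      where x≤y = ≮⇒≥ y≮x
    ... | no z≮x rewrite ⊓-≤ x y (≮⇒≥ y≮x) | ⊓-≤ x z (≮⇒≥ z≮x) = ⊓-cong x _ _
          (trans (m≤n⇒m⊓n≡m (≤-trans (⊓-glb x≤y x≤z) (lower y z))) (sym (x⊓top x)))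
      where x≤y = ≮⇒≥ y≮x
            x≤z = ≮⇒≥ z≮x

    sh4 : ∀ x → app t x x ≡ fromℕ m
    sh4 x = toℕ-injective (trans (diagonal x) (sym (toℕ-fromℕ m)))

  AdmissibleRow : Fin (suc m) → Set
  AdmissibleRow y = Continues m (toℕ y) 0 (λ _ → 0) (lookup t y)

  semiHeyting⇔rows : IsSemiHeyting t ⇔ (∀ y → AdmissibleRow y)
  semiHeyting⇔rows = mk⇔
    (λ sh y → Equivalence.from (scan y) (λ z → cell y z (semiHeyting⇒admissible sh y z)))
    (λ rows → admissible⇒semiHeyting (λ y z → cell⁻ y z (Equivalence.to (scan y) (rows y) z)))
    where
    scan : ∀ y → AdmissibleRow y ⇔ (∀ z → Admissible m (toℕ y) (toℕ z) (row y (toℕ z)) (row y))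
    scan y = continues⇔ m (toℕ y) (lookup t y) 0 (λ _ → 0) (row y) (λ ()) (λ z → sym (vecℕ-lookup (lookup t y) z))
    cell : ∀ y z → Admissible m (toℕ y) (toℕ z) (y ⇒ z) (row y) → Admissible m (toℕ y) (toℕ z) (row y (toℕ z)) (row y)
    cell y z = subst (λ a → Admissible m (toℕ y) (toℕ z) a (row y)) (sym (row-⇒ y z))
    cell⁻ : ∀ y z → Admissible m (toℕ y) (toℕ z) (row y (toℕ z)) (row y) → Admissible m (toℕ y) (toℕ z) (y ⇒ z) (row y)
    cell⁻ y z = subst (λ a → Admissible m (toℕ y) (toℕ z) a (row y)) (row-⇒ y z)

Free : (y p : ℕ) → (ℕ → ℕ) → Set
Free y p h = ∀ {x} → x < p → y < x → x ≤ h x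

-- Stuck phase at value c: some value has dropped to c = position − 1, and c is
-- compatible with every value after the diagonal so far.
Stuck : (y p c : ℕ) → (ℕ → ℕ) → Set
Stuck y p c h = y ≤ c × suc c < p × (∀ {x} → x < p → y < x → x ⊓ₙ c ≡ x ⊓ₙ h x)

before-admissible : ∀ {m y p a h} → p < y → Admissible m y p a h ⇔ a ≡ p
before-admissible p<y = mk⇔ (λ adm → proj₁ adm p<y)
  λ a≡p → (λ _ → a≡p) , (λ p≡y → contradiction p≡y (<⇒≢ p<y)) , (λ y<p → contradiction y<p (<-asym p<y))

diagonal-admissible : ∀ {m y a h} → Admissible m y y a h ⇔ a ≡ m
diagonal-admissible = mk⇔ (λ adm → proj₁ (proj₂ adm) refl)
  λ a≡m → (λ y<y → contradiction y<y (<-irrefl refl)) , (λ _ → a≡m) , (λ y<y → contradiction y<y (<-irrefl refl))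

free-admissible : ∀ {m y q a h} → y ≤ q → Free y (suc q) h → Admissible m y (suc q) a h ⇔ q ≤ a
free-admissible {y = y} {q} {a} {h} y≤q free = mk⇔ to from
  where
  to : Admissible _ y (suc q) a h → q ≤ a
  to (_ , _ , above) with y ≟ q | above (s≤s y≤q)
  ... | yes refl | y≤a , _ = y≤a
  ... | no y≢q   | _ , agree = subst (_≤ a)
        (trans (agree ≤-refl y<q) (m≤n⇒m⊓n≡m (free ≤-refl y<q))) (m⊓n≤n q a)
    where y<q = ≤∧≢⇒< y≤q y≢q
  from : q ≤ a → Admissible _ y (suc q) a h
  from q≤a = (λ q+1<y → contradiction (m≤n⇒m≤1+n y≤q) (<⇒≱ q+1<y))
           , (λ q+1≡y → contradiction (sym q+1≡y) (<⇒≢ (s≤s y≤q)))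
           , λ _ → ≤-trans y≤q q≤a , λ {x} x≤q y<x →
               trans (m≤n⇒m⊓n≡m (≤-trans (s≤s⁻¹ x≤q) q≤a)) (sym (m≤n⇒m⊓n≡m (free x≤q y<x)))

stuck-admissible : ∀ {m y p c a h} → Stuck y p c h → Admissible m y p a h ⇔ a ≡ c
stuck-admissible {y = y} {p} {c} {a} {h} (y≤c , c+1<p , agree) = mk⇔ to from
  where
  y<p : y < p
  y<p = <-trans (s≤s y≤c) c+1<p
  to : Admissible _ y p a h → a ≡ c
  to (_ , _ , above) = ⊓-below (begin
    suc c ⊓ₙ a         ≡⟨ proj₂ (above y<p) c+1<p (s≤s y≤c) ⟩
    suc c ⊓ₙ h (suc c) ≡⟨ sym (agree c+1<p (s≤s y≤c)) ⟩
    suc c ⊓ₙ c         ≡⟨ m≥n⇒m⊓n≡n (n≤1+n c) ⟩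
    c                  ∎) (n<1+n c)
  from : a ≡ c → Admissible _ y p a h
  from refl = (λ p<y → contradiction y<p (<-asym p<y))
            , (λ p≡y → contradiction (sym p≡y) (<⇒≢ y<p))
            , λ _ → y≤c , agree

free-start : ∀ {y h} → Free y (suc y) h
free-start x<y+1 y<x = contradiction (s≤s⁻¹ x<y+1) (<⇒≱ y<x)

free-extend : ∀ {y p a h} → Free y p h → p ≤ a → Free y (suc p) (extend h p a)
free-extend {p = p} free p≤a {x} x<p+1 y<x with x ≟ p
... | yes refl = p≤a
... | no x≢p   = free (≤∧≢⇒< (s≤s⁻¹ x<p+1) x≢p) y<x

free-drop : ∀ {y q h} → y ≤ q → Free y (suc q) h → Stuck y (suc (suc q)) q (extend h (suc q) q)
free-drop {q = q} y≤q free = y≤q , ≤-refl , agree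
  where
  agree : ∀ {x} → x < suc (suc q) → _ < x → x ⊓ₙ q ≡ x ⊓ₙ extend _ (suc q) q x
  agree {x} x<q+2 y<x with x ≟ suc q
  ... | yes refl = refl
  ... | no x≢q+1 = trans (m≤n⇒m⊓n≡m (s≤s⁻¹ x<q+1)) (sym (m≤n⇒m⊓n≡m (free x<q+1 y<x)))
    where x<q+1 = ≤∧≢⇒< (s≤s⁻¹ x<q+2) x≢q+1

stuck-extend : ∀ {y p c h} → Stuck y p c h → Stuck y (suc p) c (extend h p c)
stuck-extend {p = p} (y≤c , c+1<p , agree) = y≤c , m<n⇒m<1+n c+1<p , agree′
  where
  agree′ : ∀ {x} → x < suc p → _ < x → x ⊓ₙ _ ≡ x ⊓ₙ extend _ p _ x
  agree′ {x} x<p+1 y<x with x ≟ p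
  ... | yes refl = refl
  ... | no x≢p   = agree (≤∧≢⇒< (s≤s⁻¹ x<p+1) x≢p) y<x

-- The number of ways to fill the L positions of a row after the diagonal (count-free);
-- it equals Σ_{i ≤ L} L!/i! (coeff-arrangements).
arrangements : ℕ → ℕ
arrangements zero    = 1
arrangements (suc k) = suc k * arrangements k + 1

module Continuations (m : ℕ) where

  continuations : (y p : ℕ) → (ℕ → ℕ) → ℕ → ℕ
  continuations y p h L = count (continues? m y p h) (allVecs L (allFin (suc m)))

  continuations-∷ : ∀ y p h L → continuations y p h (suc L) ≡
    sum (map (λ a → if does (admissible? m y p (toℕ a) h)
                    then continuations y (suc p) (extend h p (toℕ a)) L else 0) (allFin (suc m)))
  continuations-∷ y p h L =
    trans (count-cart (continues? m y p h) (allFin (suc m)) (allVecs L (allFin (suc m))))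
          (cong sum (map-cong (λ a → count-guard (admissible? m y p (toℕ a) h)
                                                 (continues? m y (suc p) (extend h p (toℕ a)))
                                                 (allVecs L (allFin (suc m))))
                               (allFin (suc m))))

  forced : ∀ {y p h L K} c → c < suc m → (∀ {a} → Admissible m y p a h ⇔ a ≡ c) →
           continuations y (suc p) (extend h p c) L ≡ K → continuations y p h (suc L) ≡ K
  forced {y} {p} {h} {L} {K} c c<n adm next = begin
    continuations y p h (suc L)                                ≡⟨ continuations-∷ y p h L ⟩
    sum (map (λ a → if does (admissible? m y p (toℕ a) h)
                    then continuations y (suc p) (extend h p (toℕ a)) L else 0) (allFin (suc m)))
                                                               ≡⟨ cong sum (map-cong choose (allFin (suc m))) ⟩
    sum (map (λ a → if does (toℕ a ≟ c) then K else 0) (allFin (suc m)))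
                                                               ≡⟨ sum-guard (λ a → toℕ a ≟ c) K (allFin (suc m)) ⟩
    count (λ a → toℕ a ≟ c) (allFin (suc m)) * K               ≡⟨ cong (_* K) (count-toℕ≡ c c<n) ⟩
    1 * K                                                      ≡⟨ *-identityˡ K ⟩
    K                                                          ∎
    where
    choose : ∀ a → (if does (admissible? m y p (toℕ a) h)
                    then continuations y (suc p) (extend h p (toℕ a)) L else 0)
                   ≡ (if does (toℕ a ≟ c) then K else 0)
    choose a with toℕ a ≟ c
    ... | yes a≡c = trans (if-yes (admissible? m y p (toℕ a) h) (Equivalence.from adm a≡c))
                   (trans (cong (λ w → continuations y (suc p) (extend h p w) L) a≡c)
                   (trans next (sym (if-yes (toℕ a ≟ c) a≡c))))
    ... | no a≢c  = trans (if-no (admissible? m y p (toℕ a) h) (a≢c ∘ Equivalence.to adm))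
                          (sym (if-no (toℕ a ≟ c) a≢c))

  count-stuck : ∀ L {y p c h} → Stuck y p c h → c < suc m → continuations y p h L ≡ 1
  count-stuck zero    stuck c<n = refl
  count-stuck (suc L) {y} {p} {c} {h} stuck c<n =
    forced {y} {p} {h} {L} c c<n (stuck-admissible stuck) (count-stuck L (stuck-extend stuck) c<n)

  -- In the free phase at position q + 1 a value a > q keeps the row free, a = q makes it
  -- stuck (one continuation) and a < q is not admissible.
  free-choice : ∀ L {y q h} → y ≤ q → q < suc m → Free y (suc q) h →
    (∀ {a} → q < a → continuations y (suc (suc q)) (extend h (suc q) a) L ≡ arrangements L) →
    ∀ (a : Fin (suc m)) →
      (if does (admissible? m y (suc q) (toℕ a) h)
       then continuations y (suc (suc q)) (extend h (suc q) (toℕ a)) L else 0)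
      ≡ (if does (suc q ≤? toℕ a) then arrangements L else 0) + (if does (toℕ a ≟ q) then 1 else 0)
  free-choice L {y} {q} {h} y≤q q<n free stayFree a with <-cmp q (toℕ a)
  ... | tri< q<a _ _ = begin
    _                       ≡⟨ if-yes (admissible? m y (suc q) (toℕ a) h) (admissible (<⇒≤ q<a)) ⟩
    _                       ≡⟨ stayFree q<a ⟩
    arrangements L          ≡⟨ +-identityʳ (arrangements L) ⟨
    arrangements L + 0      ≡⟨ cong₂ _+_ (sym (if-yes (suc q ≤? toℕ a) q<a)) (sym (if-no (toℕ a ≟ q) (<⇒≢ q<a ∘ sym))) ⟩
    _                       ∎
    where admissible = Equivalence.from (free-admissible y≤q free)
  ... | tri≈ _ refl _ = begin
    _                       ≡⟨ if-yes (admissible? m y (suc q) q h) (Equivalence.from (free-admissible y≤q free) ≤-refl) ⟩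
    _                       ≡⟨ count-stuck L (free-drop y≤q free) q<n ⟩
    0 + 1                   ≡⟨ cong₂ _+_ (sym (if-no (suc q ≤? q) (<-irrefl refl))) (sym (if-yes (q ≟ q) refl)) ⟩
    _                       ∎
  ... | tri> _ _ a<q = begin
    _                       ≡⟨ if-no (admissible? m y (suc q) (toℕ a) h) (<⇒≱ a<q ∘ Equivalence.to (free-admissible y≤q free)) ⟩
    0 + 0                   ≡⟨ cong₂ _+_ (sym (if-no (suc q ≤? toℕ a) (<⇒≱ (m<n⇒m<1+n a<q)))) (sym (if-no (toℕ a ≟ q) (<⇒≢ a<q))) ⟩
    _                       ∎

  count-free : ∀ L {y p h} → y < p → p + L ≡ suc m → Free y p h → continuations y p h L ≡ arrangements L
  count-free zero    y<p e free = refl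
  count-free (suc L) {y} {suc q} {h} y<p e free = begin
    continuations y (suc q) h (suc L)                                         ≡⟨ continuations-∷ y (suc q) h L ⟩
    sum (map _ values)                                                        ≡⟨ cong sum (map-cong choices values) ⟩
    sum (map (λ a → keepFree a + dropTo a) values)                            ≡⟨ sum-+ keepFree dropTo values ⟩
    sum (map keepFree values) + sum (map dropTo values)                       ≡⟨ cong₂ _+_ (sum-guard (λ a → suc q ≤? toℕ a) (arrangements L) values)
                                                                                             (sum-guard (λ a → toℕ a ≟ q) 1 values) ⟩
    count (λ a → suc q ≤? toℕ a) values * arrangements L + count (λ a → toℕ a ≟ q) values * 1
        ≡⟨ cong₂ (λ u v → u * arrangements L + v * 1) (count-≤toℕ {suc m} (suc q)) (count-toℕ≡ q q<n) ⟩
    (suc m ∸ suc q) * arrangements L + 1                                      ≡⟨ cong (λ u → u * arrangements L + 1) remaining ⟩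
    suc L * arrangements L + 1                                                ∎
    where
    values : List (Fin (suc m))
    values = allFin (suc m)
    remaining : suc m ∸ suc q ≡ suc L
    remaining = trans (cong (_∸ suc q) (sym e)) (m+n∸m≡n (suc q) (suc L))
    q<n : q < suc m
    q<n = subst (q <_) e (m≤m+n (suc q) (suc L))
    keepFree dropTo : Fin (suc m) → ℕ
    keepFree a = if does (suc q ≤? toℕ a) then arrangements L else 0
    dropTo a = if does (toℕ a ≟ q) then 1 else 0
    choices : ∀ a → _ ≡ keepFree a + dropTo a
    choices = free-choice L (s≤s⁻¹ y<p) q<n free
      (λ q<a → count-free L (m<n⇒m<1+n y<p) (trans (sym (+-suc (suc q) L)) e) (free-extend free q<a))

  -- Before the diagonal and on it each value is forced; then the free phase starts.
  count-before : ∀ L {y p h} → p ≤ y → y ≤ m → p + L ≡ suc m →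
                 continuations y p h L ≡ arrangements (m ∸ y)
  count-before zero {p = p} p≤y y≤m e =
    contradiction (≤-trans p≤y y≤m) (<⇒≱ (subst (m <_) (trans (sym e) (+-identityʳ p)) ≤-refl))
  count-before (suc L) {y} {p} {h} p≤y y≤m e with p ≟ y
  ... | yes refl = forced {y} {p} {h} {L} m ≤-refl diagonal-admissible
                     (trans (count-free L ≤-refl (trans (sym (+-suc p L)) e) (free-start {h = extend h p m})) (cong arrangements L≡m∸p))
    where
    L≡m∸p : L ≡ m ∸ p
    L≡m∸p = sym (trans (cong (_∸ p) (suc-injective (trans (sym e) (+-suc p L)))) (m+n∸m≡n p L))
  ... | no p≢y   = forced {y} {p} {h} {L} p (s≤s (≤-trans p≤y y≤m)) (before-admissible p<y)
                     (count-before L p<y y≤m (trans (sym (+-suc p L)) e))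
    where p<y = ≤∧≢⇒< p≤y p≢y

  count-rows : ∀ y → y ≤ m → continuations y 0 (λ _ → 0) (suc m) ≡ arrangements (m ∸ y)
  count-rows y y≤m = count-before (suc m) z≤n y≤m refl

N-rows : ∀ m → N (suc m) ≡ ∏ (λ (y : Fin (suc m)) → arrangements (m ∸ toℕ y))
N-rows m = begin
  N (suc m)                                                            ≡⟨ count-≐ isSemiHeyting? allRows? sameTables (allTables (suc m)) ⟩
  count allRows? (allVecs (suc m) rows)                                ≡⟨ count-allVecs (λ y → continues? m (toℕ y) 0 (λ _ → 0)) rows ⟩
  ∏ (λ (y : Fin (suc m)) → continuations (toℕ y) 0 (λ _ → 0) (suc m)) ≡⟨ ∏-cong (λ y → count-rows (toℕ y) (toℕ≤pred[n] y)) ⟩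
  ∏ (λ (y : Fin (suc m)) → arrangements (m ∸ toℕ y))                   ∎
  where
  open Continuations m
  allRows? : Decidable (λ (t : Table (suc m)) → ∀ y → AdmissibleRow t y)
  allRows? t = all? (λ y → continues? m (toℕ y) 0 (λ _ → 0) (lookup t y))
  rows : List (Vec (Fin (suc m)) (suc m))
  rows = allVecs (suc m) (allFin (suc m))
  sameTables : IsSemiHeyting ≐ (λ t → ∀ y → AdmissibleRow t y)
  sameTables = (λ {t} → Equivalence.to (semiHeyting⇔rows t)) , (λ {t} → Equivalence.from (semiHeyting⇔rows t))

ratio-step : ∀ k i → i ≤ k → ratio (suc (suc k)) i ≡ suc k * ratio (suc k) i
ratio-step k i i≤k = *-/-assoc (suc k) {{i !≢0}} (m≤n⇒m!∣n! i≤k)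

coeff-arrangements : ∀ k → coeff (suc k) ≡ arrangements k
coeff-arrangements zero    = refl
coeff-arrangements (suc k) = begin
  sum (map r (upTo (2 + k)))                                   ≡⟨ cong (sum ∘ map r) (sym (upTo-∷ʳ (suc k))) ⟩
  sum (map r (upTo (suc k) ∷ʳ suc k))                          ≡⟨ cong sum (map-++ r (upTo (suc k)) (suc k ∷ [])) ⟩
  sum (map r (upTo (suc k)) ++ r (suc k) ∷ [])                 ≡⟨ sum-++ (map r (upTo (suc k))) (r (suc k) ∷ []) ⟩
  sum (map r (upTo (suc k))) + (r (suc k) + 0)                 ≡⟨ cong₂ _+_ (cong sum (map-cong-local (applyUpTo⁺₁ id (suc k) (λ i<k+1 → ratio-step k _ (s≤s⁻¹ i<k+1)))))
                                                                            (trans (+-identityʳ _) (n/n≡1 (suc k !) {{suc k !≢0}})) ⟩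
  sum (map (λ i → suc k * ratio (suc k) i) (upTo (suc k))) + 1 ≡⟨ cong (_+ 1) (sum-* (suc k) (ratio (suc k)) (upTo (suc k))) ⟩
  suc k * coeff (suc k) + 1                                    ≡⟨ cong (λ c → suc k * c + 1) (coeff-arrangements k) ⟩
  suc k * arrangements k + 1                                   ∎
  where
  r : ℕ → ℕ
  r = ratio (2 + k)

-- Splitting off the factor of row 0 leaves exactly the product for the chain one shorter.
mainTheorem2 : ∀ (n : ℕ) → 2 ≤ n → N n ≡ coeff n * N (n ∸ 1)
mainTheorem2 (suc (suc k)) _ = begin
  N (2 + k)                                                                ≡⟨ N-rows (suc k) ⟩
  ∏ (λ (y : Fin (2 + k)) → arrangements (suc k ∸ toℕ y))                   ≡⟨⟩
  arrangements (suc k) * ∏ (λ (y : Fin (suc k)) → arrangements (k ∸ toℕ y))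
      ≡⟨ cong₂ _*_ (sym (coeff-arrangements (suc k))) (sym (N-rows k)) ⟩
  coeff (2 + k) * N (suc k)                                                ∎
mainTheorem2 (suc zero) (s≤s ())
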